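{- There is an absolute constant $C$ such that the following holds. Let $K\ge1$ and let $d,u,v$ be integers with $0\le d\le K$ and $\sqrt K/8\le u\le v\le\sqrt K$. For integers $j,\nu$ with $0\le j\le u$ and $0\le\nu\le v+d+u-j$ put $$A_{j,\nu}=\frac{(v-\nu+1)(v-\nu+2)\cdots(v-\nu+u-j)}{(u-j)!\,(d+v-\nu+u-j)!}.$$ Then for all such $j,\nu$, $$\Big|\frac{A_{j,\nu}}{A_{0,0}}\Big|\le (CK)^{j+\nu}.$$
   Context: An empty product equals $1$. -}

module Defs where

open import Data.Nat as ℕ using (ℕ; zero; suc; _∸_; _!)
open import Data.Nat.Properties using (_!*_!≢0)
open import Data.Integer as ℤ using (ℤ; +_)
open import Data.Rational as ℚ using (ℚ)

risingProd : ℤ → ℕ → ℤ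
risingProd a zero    = + 1
risingProd a (suc m) = risingProd a m ℤ.* (a ℤ.+ + suc m)

-- A d u v j ν = (v-ν+1)...(v-ν+u-j) / ((u-j)! (d+v-ν+u-j)!)
-- (truncated subtraction is exact under the hypotheses j ≤ u, ν ≤ v+d+u-j)
A : (d u v j ν : ℕ) → ℚ
A d u v j ν =
  ℚ._/_ (risingProd (+ v ℤ.- + ν) (u ∸ j)) ((u ∸ j) ! ℕ.* ((d ℕ.+ v ℕ.+ (u ∸ j)) ∸ ν) !)
    {{(u ∸ j) !*((d ℕ.+ v ℕ.+ (u ∸ j)) ∸ ν) !≢0}}

ℕtoℚ : ℕ → ℚ
ℕtoℚ n = ℚ._/_ (+ n) 1

-- Put m = u − j and P(a, m) = (a+1)⋯(a+m), so that P(a, m)/m! = C(a+m, m). Then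
--   A_{j,ν}/A_{0,0} = P(v−ν, m)/m! · u!/P(v, u) · (d+v+u)!/(d+v+m−ν)!.
-- The last factor is a product of j+ν integers at most d+v+u ≤ 3K. If ν ≤ v the first two factors give
-- C(v−ν+m, m)/C(v+u, u) ≤ 1; if ν > v then |P(v−ν, m)| ≤ P(ν−v, m), C(ν−v+m, m) ≤ 2^ν and P(v, u) ≥ u!.
-- Hence C = 6 works.
module Submission where

open import Defs
open import Data.Nat as ℕ using (ℕ; _∸_; zero; suc; _!; _+_; _*_; _^_; _≤_; z≤n; _≤?_)
open import Data.Nat.Properties
open import Data.Nat.Tactic.RingSolver using (solve-∀)
open import Data.Integer as ℤ using (+_; _⊖_; ∣_∣)
import Data.Integer.Properties as ℤ
open import Data.Product using (Σ; _,_)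
import Data.Rational as ℚ
import Data.Rational.Properties as ℚ
import Data.Rational.Unnormalised as ℚᵘ
import Data.Rational.Unnormalised.Properties as ℚᵘ
open import Function using (_$_)
open import Relation.Binary.PropositionalEquality
open import Relation.Nullary using (yes; no)

rising : ℕ → ℕ → ℕ
rising a zero    = 1
rising a (suc m) = rising a m * (a + suc m)

risingProd-+ : ∀ a m → risingProd (+ a) m ≡ + rising a m
risingProd-+ a zero    = refl
risingProd-+ a (suc m) = begin
  risingProd (+ a) m ℤ.* + (a + suc m)  ≡⟨ cong (ℤ._* + (a + suc m)) (risingProd-+ a m) ⟩
  + rising a m ℤ.* + (a + suc m)        ≡⟨ ℤ.pos-* (rising a m) (a + suc m) ⟨
  + rising a (suc m)                    ∎
  where open ≡-Reasoning

∣risingProd∣≤rising : ∀ a m → ∣ risingProd a m ∣ ≤ rising ∣ a ∣ m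
∣risingProd∣≤rising a zero    = ≤-refl
∣risingProd∣≤rising a (suc m) = begin
  ∣ risingProd a m ℤ.* (a ℤ.+ + suc m) ∣          ≡⟨ ℤ.abs-* (risingProd a m) (a ℤ.+ + suc m) ⟩
  ∣ risingProd a m ∣ * ∣ a ℤ.+ + suc m ∣          ≤⟨ *-mono-≤ (∣risingProd∣≤rising a m) (ℤ.∣i+j∣≤∣i∣+∣j∣ a (+ suc m)) ⟩
  rising ∣ a ∣ m * (∣ a ∣ + suc m)               ∎
  where open ≤-Reasoning

rising-monoˡ-≤ : ∀ {a b} m → a ≤ b → rising a m ≤ rising b m
rising-monoˡ-≤ zero    a≤b = ≤-refl
rising-monoˡ-≤ (suc m) a≤b = *-mono-≤ (rising-monoˡ-≤ m a≤b) (+-monoˡ-≤ (suc m) a≤b)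

rising-zeroˡ : ∀ m → rising 0 m ≡ m !
rising-zeroˡ zero    = refl
rising-zeroˡ (suc m) = trans (cong (_* suc m) (rising-zeroˡ m)) (*-comm (m !) (suc m))

n!≤rising : ∀ a n → n ! ≤ rising a n
n!≤rising a n = subst (_≤ rising a n) (rising-zeroˡ n) (rising-monoˡ-≤ n z≤n)

rising-suc : ∀ a m → rising a (suc m) ≡ suc a * rising (suc a) m
rising-suc a zero    = trans (*-identityˡ (a + 1)) (trans (+-comm a 1) (sym (*-identityʳ (suc a))))
rising-suc a (suc m) = begin
  rising a (suc m) * (a + suc (suc m))            ≡⟨ cong₂ _*_ (rising-suc a m) (+-suc a (suc m)) ⟩
  suc a * rising (suc a) m * (suc a + suc m)      ≡⟨ *-assoc (suc a) (rising (suc a) m) _ ⟩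
  suc a * (rising (suc a) m * (suc a + suc m))    ∎
  where open ≡-Reasoning

-- C(a+m, m) ≤ 2^(a+m), by induction along Pascal's rule, which for rising reads
-- rising (1+a) (1+m) = rising a (1+m) + (1+m) · rising (1+a) m.
rising≤!*2^ : ∀ a m → rising a m ≤ m ! * 2 ^ (a + m)
rising≤!*2^ zero    m = begin
  rising 0 m     ≡⟨ rising-zeroˡ m ⟩
  m !            ≡⟨ *-identityʳ (m !) ⟨
  m ! * 1        ≤⟨ *-monoʳ-≤ (m !) (m^n>0 2 m) ⟩
  m ! * 2 ^ m    ∎
  where open ≤-Reasoning
rising≤!*2^ (suc a) zero    = subst (1 ≤_) (sym (+-identityʳ _)) (m^n>0 2 (suc a + 0))
rising≤!*2^ (suc a) (suc m) = begin
  rising (suc a) m * (suc a + suc m)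
    ≡⟨ pascal a m (rising (suc a) m) ⟩
  suc a * rising (suc a) m + suc m * rising (suc a) m
    ≡⟨ cong (_+ suc m * rising (suc a) m) (rising-suc a m) ⟨
  rising a (suc m) + suc m * rising (suc a) m
    ≤⟨ +-mono-≤ (rising≤!*2^ a (suc m)) (*-monoʳ-≤ (suc m) (rising≤!*2^ (suc a) m)) ⟩
  suc m ! * 2 ^ (a + suc m) + suc m * (m ! * 2 ^ suc (a + m))
    ≡⟨ cong (λ e → suc m ! * 2 ^ (a + suc m) + suc m * (m ! * 2 ^ e)) (+-suc a m) ⟨
  suc m ! * 2 ^ (a + suc m) + suc m * (m ! * 2 ^ (a + suc m))
    ≡⟨ double m (m !) (2 ^ (a + suc m)) ⟩
  suc m ! * 2 ^ (suc a + suc m) ∎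
  where
  open ≤-Reasoning
  pascal : ∀ a m x → x * (suc a + suc m) ≡ suc a * x + suc m * x
  pascal = solve-∀
  double : ∀ m f t → suc m * f * t + suc m * (f * t) ≡ suc m * f * (2 * t)
  double = solve-∀

rising*!≤!*rising : ∀ a {m n} → m ≤ n → rising a m * n ! ≤ m ! * rising a n
rising*!≤!*rising a {m} {n} m≤n =
  subst (λ n → rising a m * n ! ≤ m ! * rising a n) (m∸n+n≡m m≤n) (shift (n ∸ m))
  where
  shift : ∀ k → rising a m * (k + m) ! ≤ m ! * rising a (k + m)
  shift zero    = ≤-reflexive (*-comm (rising a m) (m !))
  shift (suc k) = begin
    rising a m * (suc (k + m) * (k + m) !)       ≡⟨ swap (rising a m) (suc (k + m)) ((k + m) !) ⟩
    suc (k + m) * (rising a m * (k + m) !)       ≤⟨ *-monoʳ-≤ (suc (k + m)) (shift k) ⟩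
    suc (k + m) * (m ! * rising a (k + m))       ≤⟨ *-monoˡ-≤ (m ! * rising a (k + m)) (m≤n+m (suc (k + m)) a) ⟩
    (a + suc (k + m)) * (m ! * rising a (k + m)) ≡⟨ rotate (a + suc (k + m)) (m !) (rising a (k + m)) ⟩
    m ! * (rising a (k + m) * (a + suc (k + m))) ∎
    where
    open ≤-Reasoning
    swap : ∀ x y z → x * (y * z) ≡ y * (x * z)
    swap = solve-∀
    rotate : ∀ x y z → x * (y * z) ≡ y * (z * x)
    rotate = solve-∀

n!≤B^k*[n∸k]! : ∀ {B} n k → 1 ≤ B → n ≤ B → n ! ≤ B ^ k * (n ∸ k) !
n!≤B^k*[n∸k]!     n       zero    _   _   = ≤-reflexive (sym (*-identityˡ (n !)))
n!≤B^k*[n∸k]! {B} zero    (suc k) 1≤B _   = begin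
  1                ≡⟨ ^-zeroˡ (suc k) ⟨
  1 ^ suc k        ≤⟨ ^-monoˡ-≤ (suc k) 1≤B ⟩
  B ^ suc k        ≡⟨ *-identityʳ (B ^ suc k) ⟨
  B ^ suc k * 1    ∎
  where open ≤-Reasoning
n!≤B^k*[n∸k]! {B} (suc n) (suc k) 1≤B n<B = begin
  suc n * n !                  ≤⟨ *-mono-≤ n<B (n!≤B^k*[n∸k]! n k 1≤B (≤-trans (n≤1+n n) n<B)) ⟩
  B * (B ^ k * (n ∸ k) !)      ≡⟨ *-assoc B (B ^ k) ((n ∸ k) !) ⟨
  B * B ^ k * (n ∸ k) !        ∎
  where open ≤-Reasoning

^-distribʳ-* : ∀ m n o → (m * n) ^ o ≡ m ^ o * n ^ o
^-distribʳ-* m n zero    = refl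
^-distribʳ-* m n (suc o) = trans (cong (m * n *_) (^-distribʳ-* m n o)) (interchange m n (m ^ o) (n ^ o))
  where
  interchange : ∀ a b x y → a * b * (x * y) ≡ a * x * (b * y)
  interchange = solve-∀

rising∣⊖∣*!≤2^*!*rising : ∀ {m u v} ν → m ≤ u → u ≤ v →
                          rising ∣ v ⊖ ν ∣ m * u ! ≤ 2 ^ ν * (m ! * rising v u)
rising∣⊖∣*!≤2^*!*rising {m} {u} {v} ν m≤u u≤v with ν ≤? v
... | yes ν≤v = begin
  rising ∣ v ⊖ ν ∣ m * u !   ≤⟨ *-monoˡ-≤ (u !) (rising-monoˡ-≤ m ∣v⊖ν∣≤v) ⟩
  rising v m * u !           ≤⟨ rising*!≤!*rising v m≤u ⟩
  m ! * rising v u           ≤⟨ m≤n*m (m ! * rising v u) (2 ^ ν) {{m^n≢0 2 ν}} ⟩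
  2 ^ ν * (m ! * rising v u) ∎
  where
  open ≤-Reasoning
  ∣v⊖ν∣≤v : ∣ v ⊖ ν ∣ ≤ v
  ∣v⊖ν∣≤v = subst (_≤ v) (sym (trans (ℤ.∣m⊖n∣≡∣n⊖m∣ v ν) (ℤ.∣⊖∣-≤ ν≤v))) (m∸n≤m v ν)
... | no ν≰v = begin
  rising ∣ v ⊖ ν ∣ m * u !         ≡⟨ cong (λ a → rising a m * u !) (ℤ.∣⊖∣-≰ ν≰v) ⟩
  rising (ν ∸ v) m * u !           ≤⟨ *-mono-≤ (rising≤!*2^ (ν ∸ v) m) (n!≤rising v u) ⟩
  m ! * 2 ^ (ν ∸ v + m) * rising v u ≤⟨ *-monoˡ-≤ (rising v u) (*-monoʳ-≤ (m !) (^-monoʳ-≤ 2 ν∸v+m≤ν)) ⟩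
  m ! * 2 ^ ν * rising v u         ≡⟨ rearrange (m !) (2 ^ ν) (rising v u) ⟩
  2 ^ ν * (m ! * rising v u)       ∎
  where
  open ≤-Reasoning
  ν∸v+m≤ν : ν ∸ v + m ≤ ν
  ν∸v+m≤ν = begin
    ν ∸ v + m  ≤⟨ +-monoʳ-≤ (ν ∸ v) (≤-trans m≤u u≤v) ⟩
    ν ∸ v + v  ≡⟨ m∸n+n≡m (<⇒≤ (≰⇒> ν≰v)) ⟩
    ν          ∎
  rearrange : ∀ x y z → x * y * z ≡ y * (x * z)
  rearrange = solve-∀

-- |A_{j,ν}| ≤ (2B)^{j+ν} A_{0,0} cross-multiplied: 2^ν bounds the ratio of numerators,
-- B^{j+ν} the j+ν factors of (d+v+u)! missing from (d+v+u-j-ν)!.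
A-cross-bound : ∀ {B} d u v j ν → 1 ≤ B → d + v + u ≤ B → u ≤ v → j ≤ u →
                rising ∣ v ⊖ ν ∣ (u ∸ j) * (u ! * (d + v + u) !) ≤
                  (2 * B) ^ (j + ν) * rising v u * ((u ∸ j) ! * (d + v + (u ∸ j) ∸ ν) !)
A-cross-bound {B} d u v j ν 1≤B L≤B u≤v j≤u = begin
  rising a m * (u ! * L !)
    ≡⟨ *-assoc (rising a m) (u !) (L !) ⟨
  rising a m * u ! * L !
    ≤⟨ *-mono-≤ (rising∣⊖∣*!≤2^*!*rising ν (m∸n≤m u j) u≤v) (n!≤B^k*[n∸k]! L (j + ν) 1≤B L≤B) ⟩
  2 ^ ν * (m ! * rising v u) * (B ^ (j + ν) * (L ∸ (j + ν)) !)
    ≤⟨ *-monoˡ-≤ _ (*-monoˡ-≤ (m ! * rising v u) (^-monoʳ-≤ 2 (m≤n+m ν j))) ⟩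
  2 ^ (j + ν) * (m ! * rising v u) * (B ^ (j + ν) * (L ∸ (j + ν)) !)
    ≡⟨ rearrange (2 ^ (j + ν)) (m !) (rising v u) (B ^ (j + ν)) ((L ∸ (j + ν)) !) ⟩
  2 ^ (j + ν) * B ^ (j + ν) * rising v u * (m ! * (L ∸ (j + ν)) !)
    ≡⟨ cong₂ (λ x y → x * rising v u * (m ! * y !)) (^-distribʳ-* 2 B (j + ν)) L∸[j+ν]≡ ⟨
  (2 * B) ^ (j + ν) * rising v u * (m ! * (d + v + m ∸ ν) !)
    ∎
  where
  open ≤-Reasoning
  a = ∣ v ⊖ ν ∣
  m = u ∸ j
  L = d + v + u
  L∸[j+ν]≡ : d + v + m ∸ ν ≡ L ∸ (j + ν)
  L∸[j+ν]≡ = trans (cong (_∸ ν) (sym (+-∸-assoc (d + v) j≤u))) (∸-+-assoc L j ν)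
  rearrange : ∀ a b c d e → a * (b * c) * (d * e) ≡ a * d * c * (b * e)
  rearrange = solve-∀

toℚᵘ-/ : ∀ i n .{{_ : ℕ.NonZero n}} → ℚ.toℚᵘ (i ℚ./ n) ℚᵘ.≃ (i ℚᵘ./ n)
toℚᵘ-/ i (suc n) = ℚ.toℚᵘ-fromℚᵘ (ℚᵘ.mkℚᵘ i n)

∣i/q∣≤n*[p/r] : ∀ i n p q r .{{_ : ℕ.NonZero q}} .{{_ : ℕ.NonZero r}} →
                ∣ i ∣ * r ≤ n * p * q → ℚ.∣ i ℚ./ q ∣ ℚ.≤ ℕtoℚ n ℚ.* (+ p ℚ./ r)
∣i/q∣≤n*[p/r] i n p q@(suc _) r@(suc _) cross = ℚ.toℚᵘ-cancel-≤ $ begin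
  ℚ.toℚᵘ ℚ.∣ i ℚ./ q ∣                        ≃⟨ ℚ.toℚᵘ-homo-∣-∣ (i ℚ./ q) ⟩
  ℚᵘ.∣ ℚ.toℚᵘ (i ℚ./ q) ∣                     ≃⟨ ℚᵘ.∣-∣-cong (toℚᵘ-/ i q) ⟩
  ℚᵘ.∣ i ℚᵘ./ q ∣                             ≤⟨ ℚᵘ.*≤* cross-ℤ ⟩
  (+ n ℚᵘ./ 1) ℚᵘ.* (+ p ℚᵘ./ r)               ≃⟨ ℚᵘ.*-cong (toℚᵘ-/ (+ n) 1) (toℚᵘ-/ (+ p) r) ⟨
  ℚ.toℚᵘ (ℕtoℚ n) ℚᵘ.* ℚ.toℚᵘ (+ p ℚ./ r)     ≃⟨ ℚ.toℚᵘ-homo-* (ℕtoℚ n) (+ p ℚ./ r) ⟨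
  ℚ.toℚᵘ (ℕtoℚ n ℚ.* (+ p ℚ./ r))             ∎
  where
  open ℚᵘ.≤-Reasoning
  cross-ℤ : + ∣ i ∣ ℤ.* + (1 * r) ℤ.≤ (+ n ℤ.* + p) ℤ.* + q
  cross-ℤ = subst₂ ℤ._≤_
    (trans (ℤ.pos-* ∣ i ∣ r) (cong (λ e → + ∣ i ∣ ℤ.* + e) (sym (*-identityˡ r))))
    (trans (ℤ.pos-* (n * p) q) (cong (ℤ._* + q) (ℤ.pos-* n p)))
    (ℤ.+≤+ cross)

A-bound : ∀ {B} d u v j ν → 1 ≤ B → d + v + u ≤ B → u ≤ v → j ≤ u →
          ℚ.∣ A d u v j ν ∣ ℚ.≤ ℕtoℚ ((2 * B) ^ (j + ν)) ℚ.* A d u v 0 0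
A-bound {B} d u v j ν 1≤B L≤B u≤v j≤u =
  subst (λ A₀₀ → ℚ.∣ A d u v j ν ∣ ℚ.≤ ℕtoℚ ((2 * B) ^ (j + ν)) ℚ.* A₀₀)
        (cong (ℚ._/ q₀) (sym risingProd-v-0))
        (∣i/q∣≤n*[p/r] P ((2 * B) ^ (j + ν)) (rising v u) q q₀ (begin
          (∣ P ∣) * q₀                              ≤⟨ *-monoˡ-≤ q₀ (∣risingProd∣≤rising (+ v ℤ.- + ν) (u ∸ j)) ⟩
          rising (∣ + v ℤ.- + ν ∣) (u ∸ j) * q₀      ≡⟨ cong (λ a → rising ∣ a ∣ (u ∸ j) * q₀) (ℤ.[+m]-[+n]≡m⊖n v ν) ⟩
          rising (∣ v ⊖ ν ∣) (u ∸ j) * q₀            ≤⟨ A-cross-bound d u v j ν 1≤B L≤B u≤v j≤u ⟩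
          (2 * B) ^ (j + ν) * rising v u * q         ∎))
  where
  open ≤-Reasoning
  P = risingProd (+ v ℤ.- + ν) (u ∸ j)
  q = (u ∸ j) ! * (d + v + (u ∸ j) ∸ ν) !
  q₀ = u ! * (d + v + u) !
  instance
    q≢0 : ℕ.NonZero q
    q≢0 = (u ∸ j) !* (d + v + (u ∸ j) ∸ ν) !≢0
    q₀≢0 : ℕ.NonZero q₀
    q₀≢0 = u !* (d + v + u) !≢0
  risingProd-v-0 : risingProd (+ v ℤ.- + 0) u ≡ + rising v u
  risingProd-v-0 = trans (cong (λ a → risingProd a u) (ℤ.+-identityʳ (+ v))) (risingProd-+ v u)

lemma6 : Σ ℕ λ C → (K d u v : ℕ) → 1 ℕ.≤ K → d ℕ.≤ K → K ℕ.≤ 64 ℕ.* (u ℕ.* u) → u ℕ.≤ v → v ℕ.* v ℕ.≤ K →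
           (j ν : ℕ) → j ℕ.≤ u → ν ℕ.≤ v ℕ.+ d ℕ.+ (u ∸ j) →
           ℚ.∣ A d u v j ν ∣ ℚ.≤ ℕtoℚ ((C ℕ.* K) ℕ.^ (j ℕ.+ ν)) ℚ.* A d u v 0 0
lemma6 = 6 , λ K d u v 1≤K d≤K _ u≤v v*v≤K j ν j≤u _ →
  let v≤K = ≤-trans (n≤n*n v) v*v≤K
      d+v+u≤3K = ≤-trans (+-mono-≤ (+-mono-≤ d≤K v≤K) (≤-trans u≤v v≤K)) (≤-reflexive (K+K+K≡3*K K))
  in subst (λ c → ℚ.∣ A d u v j ν ∣ ℚ.≤ ℕtoℚ (c ^ (j + ν)) ℚ.* A d u v 0 0)
           (sym (*-assoc 2 3 K))
           (A-bound d u v j ν (≤-trans 1≤K (m≤m+n K _)) d+v+u≤3K u≤v j≤u)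
  where
  n≤n*n : ∀ n → n ≤ n * n
  n≤n*n zero    = z≤n
  n≤n*n (suc n) = m≤m*n (suc n) (suc n)
  K+K+K≡3*K : ∀ K → K + K + K ≡ 3 * K
  K+K+K≡3*K = solve-∀
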